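{- There is no $\tau$-retentive tournament with exactly $4$ vertices. That is, there is no tournament $T$ having a minimal $\tau$-retentive set $R$ with $|R|=4$.
   Context: A tournament $T$ consists of a finite vertex set $V(T)$ and an asymmetric, complete binary relation $\succ$ on $V(T)$: for distinct $x,y$ exactly one of $x\succ y$, $y\succ x$ holds, and we say $x$ dominates $y$ if $x\succ y$. For $v\in V(T)$ let $N^-_T(v)=\{u\in V(T): u\succ v\}$. For $B\subseteq V(T)$, $T[B]$ is the subtournament induced by $B$. The tournament equilibrium set $\tau$ is defined recursively on the number of vertices: for a tournament $T$, a nonempty set $A\subseteq V(T)$ is $\tau$-retentive if for every $v\in A$ with $N^-_T(v)\neq\emptyset$ we have $\tau(T[N^-_T(v)])\subseteq A$; $A$ is a minimal $\tau$-retentive set if no $\tau$-retentive set of $T$ is a proper subset of $A$; and $\tau(T)$ is the union of all minimal $\tau$-retentive sets of $T$. A tournament $H$ is a $\tau$-retentive tournament if there is a tournament $T$ with a minimal $\tau$-retentive set $R$ such that $T[R]$ is isomorphic to $H$. -}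

module Defs where

open import Data.Nat using (ℕ; zero; suc)
open import Data.Fin using (Fin)
open import Data.Fin.Subset using (Subset; _∈_; _⊆_; Nonempty; ⊤; inside; outside)
open import Data.Vec using (tabulate; lookup)
open import Data.Bool using (Bool; true; false; _∧_)
open import Data.Product using (Σ; _×_; ∃)
open import Data.Sum using (_⊎_)
open import Data.Empty using (⊥)
open import Relation.Nullary using (¬_)
open import Relation.Nullary.Decidable using (⌊_⌋)
open import Relation.Binary.PropositionalEquality using (_≡_; _≢_)
open import Relation.Binary using (Decidable)

record Tournament (n : ℕ) : Set₁ where
  field
    _≻_      : Fin n → Fin n → Set
    asym     : ∀ {x y} → x ≻ y → ¬ (y ≻ x)
    complete : ∀ {x y} → x ≢ y → (x ≻ y) ⊎ (y ≻ x)
    dec      : Decidable _≻_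

module _ {n : ℕ} (T : Tournament n) where
  open Tournament T

  -- Subtournaments T[S] are represented by their vertex set S ⊆ Fin n.
  -- In-neighbourhood of v inside T[S]:  N⁻_{T[S]}(v) = { u ∈ S : u ≻ v }.
  inNbhd : Subset n → Fin n → Subset n
  inNbhd S v = tabulate λ u → lookup S u ∧ ⌊ dec u v ⌋

  -- Retentive / minimal retentive sets of T[S], given a notion of τ
  -- (as a predicate "x ∈ τ(T[S'])") for the smaller subtournaments.
  RetentiveWrt : (Subset n → Fin n → Set) → Subset n → Subset n → Set
  RetentiveWrt τ' S A =
    Nonempty A × A ⊆ S ×
    (∀ v → v ∈ A → Nonempty (inNbhd S v) → ∀ u → τ' (inNbhd S v) u → u ∈ A)

  MinimalRetentiveWrt : (Subset n → Fin n → Set) → Subset n → Subset n → Set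
  MinimalRetentiveWrt τ' S A =
    RetentiveWrt τ' S A ×
    (∀ B → RetentiveWrt τ' S B → B ⊆ A → A ⊆ B)

  -- τ with fuel: InTauF k S x  means  x ∈ τ(T[S]), valid whenever k ≥ ∣S∣
  -- (recursive calls are on in-neighbourhoods, which are strictly smaller).
  InTauF : ℕ → Subset n → Fin n → Set
  InTauF zero    S x = ⊥
  InTauF (suc k) S x = ∃ λ A → MinimalRetentiveWrt (InTauF k) S A × x ∈ A

  -- τ-retentive sets and minimal τ-retentive sets of T[S], with the
  -- recursive τ evaluated with fuel n (≥ size of every subtournament).
  τRetentive : Subset n → Subset n → Set
  τRetentive S A = RetentiveWrt (InTauF n) S A

  MinimalτRetentive : Subset n → Subset n → Set
  MinimalτRetentive S A = MinimalRetentiveWrt (InTauF n) S A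

-- Let R be a minimal τ-retentive set of T. A vertex of R dominated by no
-- other vertex of R forms a τ-retentive set on its own, and a vertex of R
-- dominating no other vertex of R can be deleted from R without losing
-- τ-retentiveness; by minimality, T[R] has neither a source nor a sink
-- once ∣R∣ ≥ 2. The only 4-vertex tournament without source and sink is the
-- 4-cycle a → b → c → d → a with chords a → c and b → d, and there c can be
-- deleted as well: c lies in τ of the in-neighbourhood of a vertex of R only
-- if it dominates that vertex, i.e. only for d, and τ(N⁻(d)) ⊆ R ∩ N⁻(d) =
-- {b, c}, whereas τ(X) is never confined to a pair {x, y} ⊆ X with x ≻ y
-- and y ∈ τ(X).
module Submission where

open import Defs
open import Data.Nat using (ℕ; zero; suc; _≤_; s≤s; z≤n)
open import Data.Nat.Properties using (≤-trans; ≤-pred; ≤-refl; ≤-reflexive; n≤1+n; <-irrefl)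
open import Data.Fin using (Fin; zero; suc; _≟_)
open import Data.Fin.Subset
  using (Subset; _∈_; _∉_; _⊆_; _⊂_; Nonempty; ⊤; ⁅_⁆; _─_; _-_; ∣_∣; inside; outside)
open import Data.Fin.Subset.Properties
  using ( x∈⁅x⁆; x∈⁅y⁆⇒x≡y; p─⊥≡p; p─q⊆p; x∈p∧x≢y⇒x∈p-y; x∈p⇒∣p-x∣<∣p∣
        ; nonempty?; Empty-unique; ∣⊥∣≡0; ∣p∣≤n; _⊂?_; _∈?_ )
open import Data.Fin.Subset.Induction using (⊂-wellFounded)
open import Data.Vec using (_∷_; there; lookup)
open import Data.Vec.Properties using ([]=⇒lookup; lookup⇒[]=; lookup∘tabulate)
open import Data.Bool.Properties using (T-≡; T-∧)
open import Data.Product using (∃; _×_; _,_; proj₁; proj₂)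
open import Data.Sum using (_⊎_; inj₁; inj₂)
open import Data.Empty using (⊥; ⊥-elim)
open import Function using (_∘_; id)
open import Function.Bundles using (Equivalence)
open import Induction.WellFounded using (Acc; acc)
open import Relation.Nullary using (¬_; yes; no; contradiction)
open import Relation.Nullary.Decidable using (toWitness; fromWitness; decidable-stable)
open import Relation.Binary.PropositionalEquality using (_≡_; _≢_; refl; sym; trans; subst; ≢-sym)

x∈p─q⇒x∉q : ∀ {n} (p q : Subset n) {x} → x ∈ p ─ q → x ∉ q
x∈p─q⇒x∉q (_ ∷ p) (inside  ∷ q) (there x∈p─q) (there x∈q) = x∈p─q⇒x∉q p q x∈p─q x∈q
x∈p─q⇒x∉q (_ ∷ p) (outside ∷ q) (there x∈p─q) (there x∈q) = x∈p─q⇒x∉q p q x∈p─q x∈q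

x∈p-y⇒x≢y : ∀ {n} {p : Subset n} {x y} → x ∈ p - y → x ≢ y
x∈p-y⇒x≢y {p = p} {y = y} x∈p-y refl = x∈p─q⇒x∉q p ⁅ y ⁆ x∈p-y (x∈⁅x⁆ y)

x∈p⇒⁅x⁆⊆p : ∀ {n} {p : Subset n} {x} → x ∈ p → ⁅ x ⁆ ⊆ p
x∈p⇒⁅x⁆⊆p {x = x} x∈p y∈⁅x⁆ with refl ← x∈⁅y⁆⇒x≡y x y∈⁅x⁆ = x∈p

∣p∣≤1+∣p-x∣ : ∀ {n} (p : Subset n) x → ∣ p ∣ ≤ suc ∣ p - x ∣
∣p∣≤1+∣p-x∣ (inside  ∷ p) zero    = subst (λ q → suc ∣ p ∣ ≤ suc ∣ q ∣) (sym (p─⊥≡p p)) ≤-refl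
∣p∣≤1+∣p-x∣ (outside ∷ p) zero    = subst (λ q → ∣ p ∣ ≤ suc ∣ q ∣) (sym (p─⊥≡p p)) (n≤1+n _)
∣p∣≤1+∣p-x∣ (inside  ∷ p) (suc x) = s≤s (∣p∣≤1+∣p-x∣ p x)
∣p∣≤1+∣p-x∣ (outside ∷ p) (suc x) = ∣p∣≤1+∣p-x∣ p x

x∈p∧k≤∣p-x∣⇒k<∣p∣ : ∀ {n k} {p : Subset n} {x} → x ∈ p → k ≤ ∣ p - x ∣ → suc k ≤ ∣ p ∣
x∈p∧k≤∣p-x∣⇒k<∣p∣ x∈p k≤∣p-x∣ = ≤-trans (s≤s k≤∣p-x∣) (x∈p⇒∣p-x∣<∣p∣ x∈p)

0<∣p∣⇒nonempty : ∀ {n} (p : Subset n) → 1 ≤ ∣ p ∣ → Nonempty p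
0<∣p∣⇒nonempty {n} p 0<∣p∣ with nonempty? p
... | yes p≢∅ = p≢∅
... | no p≡∅ = contradiction
  (subst (1 ≤_) (∣⊥∣≡0 n) (subst (λ q → 1 ≤ ∣ q ∣) (Empty-unique p≡∅) 0<∣p∣)) λ ()

k<∣p∣⇒∃k≤∣p-x∣ : ∀ {n k} (p : Subset n) → suc k ≤ ∣ p ∣ → ∃ λ x → x ∈ p × k ≤ ∣ p - x ∣
k<∣p∣⇒∃k≤∣p-x∣ p k<∣p∣ =
  let x , x∈p = 0<∣p∣⇒nonempty p (≤-trans (s≤s z≤n) k<∣p∣)
  in x , x∈p , ≤-pred (≤-trans k<∣p∣ (∣p∣≤1+∣p-x∣ p x))

-- R ⊆ {a, b, c, d}, phrased so that permuting the four vertices only reorders arguments.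
Covers : ∀ {n} → Subset n → Fin n → Fin n → Fin n → Fin n → Set
Covers R a b c d = ∀ {v} → v ∈ R → v ≢ a → v ≢ b → v ≢ c → v ≢ d → ⊥

covers-all : ∀ {n} {R : Subset n} {a b c d} → Covers R a b c d → (P : Fin n → Set) →
             P a → P b → P c → P d → ∀ {v} → v ∈ R → P v
covers-all {a = a} {b} {c} {d} cov P Pa Pb Pc Pd {v} v∈R with v ≟ a | v ≟ b | v ≟ c | v ≟ d
... | yes refl | _        | _        | _        = Pa
... | no _     | yes refl | _        | _        = Pb
... | no _     | no _     | yes refl | _        = Pc
... | no _     | no _     | no _     | yes refl = Pd
... | no v≢a   | no v≢b   | no v≢c   | no v≢d   = ⊥-elim (cov v∈R v≢a v≢b v≢c v≢d)

record FourElements {n} (R : Subset n) : Set where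
  field
    a b c d : Fin n
    a∈R : a ∈ R
    b∈R : b ∈ R
    c∈R : c ∈ R
    d∈R : d ∈ R
    a≢b : a ≢ b
    a≢c : a ≢ c
    a≢d : a ≢ d
    b≢c : b ≢ c
    b≢d : b ≢ d
    c≢d : c ≢ d
    covers : Covers R a b c d

∣p∣≡4⇒fourElements : ∀ {n} (R : Subset n) → ∣ R ∣ ≡ 4 → FourElements R
∣p∣≡4⇒fourElements R ∣R∣≡4
  with a , a∈R     , 3≤∣R-a∣     ← k<∣p∣⇒∃k≤∣p-x∣ R (≤-reflexive (sym ∣R∣≡4))
  with b , b∈R-a   , 2≤∣R-a-b∣   ← k<∣p∣⇒∃k≤∣p-x∣ (R - a) 3≤∣R-a∣
  with c , c∈R-a-b , 1≤∣R-a-b-c∣ ← k<∣p∣⇒∃k≤∣p-x∣ (R - a - b) 2≤∣R-a-b∣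
  with d , d∈R-a-b-c , _        ← k<∣p∣⇒∃k≤∣p-x∣ (R - a - b - c) 1≤∣R-a-b-c∣
  = record
  { a = a ; b = b ; c = c ; d = d
  ; a∈R = a∈R ; b∈R = b∈R ; c∈R = c∈R ; d∈R = d∈R
  ; a≢b = ≢-sym (x∈p-y⇒x≢y b∈R-a)
  ; a≢c = ≢-sym (x∈p-y⇒x≢y c∈R-a)
  ; a≢d = ≢-sym (x∈p-y⇒x≢y d∈R-a)
  ; b≢c = ≢-sym (x∈p-y⇒x≢y c∈R-a-b)
  ; b≢d = ≢-sym (x∈p-y⇒x≢y d∈R-a-b)
  ; c≢d = ≢-sym (x∈p-y⇒x≢y d∈R-a-b-c)
  ; covers = λ v∈R v≢a v≢b v≢c v≢d → <-irrefl (sym ∣R∣≡4) (5≤∣R∣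
      (x∈p∧x≢y⇒x∈p-y (x∈p∧x≢y⇒x∈p-y (x∈p∧x≢y⇒x∈p-y (x∈p∧x≢y⇒x∈p-y v∈R v≢a) v≢b) v≢c) v≢d))
  }
  where
  5≤∣R∣ : ∀ {v} → v ∈ R - a - b - c - d → 5 ≤ ∣ R ∣
  5≤∣R∣ v∈R-a-b-c-d =
    x∈p∧k≤∣p-x∣⇒k<∣p∣ a∈R (x∈p∧k≤∣p-x∣⇒k<∣p∣ b∈R-a (x∈p∧k≤∣p-x∣⇒k<∣p∣ c∈R-a-b
      (x∈p∧k≤∣p-x∣⇒k<∣p∣ d∈R-a-b-c (x∈p∧k≤∣p-x∣⇒k<∣p∣ v∈R-a-b-c-d z≤n))))
  d∈R-a-b : d ∈ R - a - b
  d∈R-a-b = p─q⊆p (R - a - b) ⁅ c ⁆ d∈R-a-b-c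
  d∈R-a : d ∈ R - a
  d∈R-a = p─q⊆p (R - a) ⁅ b ⁆ d∈R-a-b
  d∈R : d ∈ R
  d∈R = p─q⊆p R ⁅ a ⁆ d∈R-a
  c∈R-a : c ∈ R - a
  c∈R-a = p─q⊆p (R - a) ⁅ b ⁆ c∈R-a-b
  c∈R : c ∈ R
  c∈R = p─q⊆p R ⁅ a ⁆ c∈R-a
  b∈R : b ∈ R
  b∈R = p─q⊆p R ⁅ a ⁆ b∈R-a

module _ {n : ℕ} (T : Tournament n) where
  open Tournament T

  ≻-irrefl : ∀ {x} → ¬ x ≻ x
  ≻-irrefl x≻x = asym x≻x x≻x

  ≻⇒≢ : ∀ {x y} → x ≻ y → x ≢ y
  ≻⇒≢ x≻y refl = ≻-irrefl x≻y

  ≻-≻⇒≢ : ∀ {x y z} → x ≻ y → y ≻ z → x ≢ z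
  ≻-≻⇒≢ x≻y y≻z refl = asym x≻y y≻z

  ∈inNbhd⁻ : ∀ S v {u} → u ∈ inNbhd T S v → u ∈ S × u ≻ v
  ∈inNbhd⁻ S v {u} u∈N =
    let T[u∈S] , T[u≻v] = Equivalence.to T-∧
          (Equivalence.from T-≡ (trans (sym (lookup∘tabulate _ u)) ([]=⇒lookup u∈N)))
    in lookup⇒[]= u S (Equivalence.to T-≡ T[u∈S]) , toWitness T[u≻v]

  ∈inNbhd⁺ : ∀ {S v u} → u ∈ S → u ≻ v → u ∈ inNbhd T S v
  ∈inNbhd⁺ {S} {v} {u} u∈S u≻v = lookup⇒[]= u (inNbhd T S v)
    (trans (lookup∘tabulate _ u) (Equivalence.to T-≡ (Equivalence.from T-∧
      (Equivalence.from T-≡ ([]=⇒lookup u∈S) , fromWitness u≻v))))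

  τ⊆ : ∀ k S {u} → InTauF T k S u → u ∈ S
  τ⊆ (suc k) _ (_ , ((_ , A⊆S , _) , _) , u∈A) = A⊆S u∈A

  module _ {τ' : Subset n → Fin n → Set} {S : Subset n} where

    retentive-singleton : ∀ {x} → x ∈ S → (∀ u → ¬ τ' (inNbhd T S x) u) →
                          RetentiveWrt T τ' S ⁅ x ⁆
    retentive-singleton {x} x∈S τ-empty =
      (x , x∈⁅x⁆ x) , x∈p⇒⁅x⁆⊆p x∈S , λ v v∈⁅x⁆ _ u → ⊥-elim ∘ τ-empty-at v∈⁅x⁆ u
      where
      τ-empty-at : ∀ {v} → v ∈ ⁅ x ⁆ → ∀ u → ¬ τ' (inNbhd T S v) u
      τ-empty-at v∈⁅x⁆ with refl ← x∈⁅y⁆⇒x≡y x v∈⁅x⁆ = τ-empty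

    retentive-minus : ∀ {R c x} → RetentiveWrt T τ' S R → x ∈ R → x ≢ c →
                      (∀ {v} → v ∈ R → v ≢ c → ¬ τ' (inNbhd T S v) c) →
                      RetentiveWrt T τ' S (R - c)
    retentive-minus {R} {c} (_ , R⊆S , closed) x∈R x≢c c∉τ =
      (_ , x∈p∧x≢y⇒x∈p-y x∈R x≢c) , R⊆S ∘ p─q⊆p R ⁅ c ⁆ ,
      λ v v∈R-c N⁻v≢∅ u τu → x∈p∧x≢y⇒x∈p-y (closed v (p─q⊆p R ⁅ c ⁆ v∈R-c) N⁻v≢∅ u τu)
        λ { refl → c∉τ (p─q⊆p R ⁅ c ⁆ v∈R-c) (x∈p-y⇒x≢y v∈R-c) τu }

    minimal-exists : ∀ {A} → RetentiveWrt T τ' S A → ¬ (∀ M → ¬ MinimalRetentiveWrt T τ' S M)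
    minimal-exists {A} = descend A (⊂-wellFounded A)
      where
      descend : ∀ A → Acc _⊂_ A → RetentiveWrt T τ' S A →
                ¬ (∀ M → ¬ MinimalRetentiveWrt T τ' S M)
      descend A (acc smaller) A-ret no-minimal = no-minimal A (A-ret , minimality)
        where
        minimality : ∀ B → RetentiveWrt T τ' S B → B ⊆ A → A ⊆ B
        minimality B B-ret B⊆A {x} x∈A with B ⊂? A
        ... | yes B⊂A = ⊥-elim (descend B (smaller B⊂A) B-ret no-minimal)
        ... | no B⊄A = decidable-stable (x ∈? B) λ x∉B → B⊄A (B⊆A , x , x∈A , x∉B)

    minimal-minus : ∀ {R c} → MinimalRetentiveWrt T τ' S R → c ∈ R → ¬ RetentiveWrt T τ' S (R - c)
    minimal-minus {R} {c} (_ , minimal) c∈R R-c-ret =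
      x∈p-y⇒x≢y (minimal (R - c) R-c-ret (p─q⊆p R ⁅ c ⁆) c∈R) refl

  module _ {k : ℕ} {S : Subset n} where

    τ-dominators : ∀ {A v u} → RetentiveWrt T (InTauF T k) S A → v ∈ A →
                   InTauF T k (inNbhd T S v) u → u ∈ A × u ≻ v
    τ-dominators {v = v} {u} (_ , _ , closed) v∈A τu =
      closed v v∈A (_ , u∈N⁻v) _ τu , proj₂ (∈inNbhd⁻ S v u∈N⁻v)
      where
      u∈N⁻v : u ∈ inNbhd T S v
      u∈N⁻v = τ⊆ k (inNbhd T S v) τu

    source-singleton : ∀ {R s} → MinimalRetentiveWrt T (InTauF T k) S R → s ∈ R →
                       (∀ {v} → v ∈ R → ¬ v ≻ s) → ∀ {v} → v ∈ R → v ≡ s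
    source-singleton {R} {s} (R-ret@(_ , R⊆S , _) , minimal) s∈R undominated v∈R =
      x∈⁅y⁆⇒x≡y s (minimal ⁅ s ⁆ ⁅s⁆-ret (x∈p⇒⁅x⁆⊆p s∈R) v∈R)
      where
      τ-empty : ∀ u → ¬ InTauF T k (inNbhd T S s) u
      τ-empty u τu = let u∈R , u≻s = τ-dominators R-ret s∈R τu in undominated u∈R u≻s
      ⁅s⁆-ret : RetentiveWrt T (InTauF T k) S ⁅ s ⁆
      ⁅s⁆-ret = retentive-singleton {τ' = InTauF T k} (R⊆S s∈R) τ-empty

    sink-singleton : ∀ {R s} → MinimalRetentiveWrt T (InTauF T k) S R → s ∈ R →
                     (∀ {v} → v ∈ R → ¬ s ≻ v) → ∀ {v} → v ∈ R → v ≡ s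
    sink-singleton {R} {s} R-min@(R-ret , _) s∈R dominates-none {v} v∈R with v ≟ s
    ... | yes v≡s = v≡s
    ... | no v≢s = ⊥-elim (minimal-minus {τ' = InTauF T k} R-min s∈R R-s-ret)
      where
      R-s-ret : RetentiveWrt T (InTauF T k) S (R - s)
      R-s-ret = retentive-minus {τ' = InTauF T k} R-ret v∈R v≢s λ w∈R _ τs →
        dominates-none w∈R (proj₂ (τ-dominators R-ret w∈R τs))

  τ-nonempty : ∀ k {S} → Nonempty S → ¬ (∀ u → ¬ InTauF T (suc k) S u)
  τ-nonempty k {S} S≢∅ τ-empty =
    minimal-exists {τ' = InTauF T k} S-ret λ M M-min →
      let u , u∈M = proj₁ (proj₁ M-min) in τ-empty u (M , M-min , u∈M)
    where
    S-ret : RetentiveWrt T (InTauF T k) S S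
    S-ret = S≢∅ , id , λ v _ _ _ τu → proj₁ (∈inNbhd⁻ S v (τ⊆ k (inNbhd T S v) τu))

  retentive-has-dominator : ∀ {k S A v} → RetentiveWrt T (InTauF T (suc k)) S A → v ∈ A →
                            Nonempty (inNbhd T S v) → ¬ (∀ {u} → u ∈ A → ¬ u ≻ v)
  retentive-has-dominator {k} A-ret v∈A N⁻v≢∅ undominated = τ-nonempty k N⁻v≢∅ λ u τu →
    let u∈A , u≻v = τ-dominators A-ret v∈A τu in undominated u∈A u≻v

  τ⊈dominatedPair : ∀ {k X x y} → x ∈ X → x ≻ y → InTauF T (suc (suc k)) X y →
                    ¬ (∀ {z} → InTauF T (suc (suc k)) X z → z ≡ x ⊎ z ≡ y)
  τ⊈dominatedPair {x = x} {y} x∈X x≻y (M , M-min , y∈M) τ⊆xy =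
    retentive-has-dominator (proj₁ M-min) y∈M (x , ∈inNbhd⁺ x∈X x≻y) y-undominated
    where
    M⊆xy : ∀ {z} → z ∈ M → z ≡ x ⊎ z ≡ y
    M⊆xy z∈M = τ⊆xy (M , M-min , z∈M)
    x-undominated : ∀ {v} → v ∈ M → ¬ v ≻ x
    x-undominated v∈M with M⊆xy v∈M
    ... | inj₁ refl = ≻-irrefl
    ... | inj₂ refl = asym x≻y
    x∉M : x ∉ M
    x∉M x∈M = ≻⇒≢ x≻y (sym (source-singleton M-min x∈M x-undominated y∈M))
    y-undominated : ∀ {u} → u ∈ M → ¬ u ≻ y
    y-undominated u∈M with M⊆xy u∈M
    ... | inj₁ refl = λ _ → x∉M u∈M
    ... | inj₂ refl = ≻-irrefl

  removable-excluded : ∀ {k S R b c d} → MinimalRetentiveWrt T (InTauF T (suc (suc k))) S R →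
                       c ∈ R → b ∈ R → b ≻ c → b ≻ d →
                       (∀ {v} → v ∈ R → c ≻ v → v ≡ d) →
                       (∀ {z} → z ∈ R → z ≻ d → z ≡ b ⊎ z ≡ c) → ⊥
  removable-excluded {k} {S} {R} {b} {c} R-min@(R-ret , _) c∈R b∈R b≻c b≻d
                     c-beats-only-d d-beaten-by-b,c =
    minimal-minus {τ' = InTauF T (suc (suc k))} R-min c∈R R-c-ret
    where
    c∉τ : ∀ {v} → v ∈ R → v ≢ c → ¬ InTauF T (suc (suc k)) (inNbhd T S v) c
    c∉τ v∈R _ τc with refl ← c-beats-only-d v∈R (proj₂ (τ-dominators R-ret v∈R τc)) =
      τ⊈dominatedPair (∈inNbhd⁺ (proj₁ (proj₂ R-ret) b∈R) b≻d) b≻c τc λ τz →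
        let z∈R , z≻d = τ-dominators R-ret v∈R τz in d-beaten-by-b,c z∈R z≻d
    R-c-ret : RetentiveWrt T (InTauF T (suc (suc k))) S (R - c)
    R-c-ret = retentive-minus {τ' = InTauF T (suc (suc k))} R-ret b∈R (≻⇒≢ b≻c) c∉τ

module _ {n k} (T : Tournament n) {S R : Subset n}
         (R-min : MinimalRetentiveWrt T (InTauF T (suc (suc k))) S R) where
  open Tournament T

  no-source₄ : ∀ {s p q r} → Covers R s p q r → s ∈ R → p ∈ R → s ≻ p → s ≻ q → s ≻ r → ⊥
  no-source₄ {s} cov s∈R p∈R s≻p s≻q s≻r =
    ≻⇒≢ T s≻p (sym (source-singleton T R-min s∈R undominated p∈R))
    where
    undominated : ∀ {v} → v ∈ R → ¬ v ≻ s
    undominated = covers-all cov (λ v → ¬ v ≻ s) (≻-irrefl T) (asym s≻p) (asym s≻q) (asym s≻r)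

  no-sink₄ : ∀ {s p q r} → Covers R s p q r → s ∈ R → p ∈ R → p ≻ s → q ≻ s → r ≻ s → ⊥
  no-sink₄ {s} cov s∈R p∈R p≻s q≻s r≻s =
    ≻⇒≢ T p≻s (sink-singleton T R-min s∈R dominates-none p∈R)
    where
    dominates-none : ∀ {v} → v ∈ R → ¬ s ≻ v
    dominates-none = covers-all cov (λ v → ¬ s ≻ v) (≻-irrefl T) (asym p≻s) (asym q≻s) (asym r≻s)

  no-removable₄ : ∀ {c d b a} → Covers R c d b a → c ∈ R → b ∈ R →
                  b ≻ c → b ≻ d → a ≻ c → d ≻ a → ⊥
  no-removable₄ {c} {d} {b} cov c∈R b∈R b≻c b≻d a≻c d≻a =
    removable-excluded T R-min c∈R b∈R b≻c b≻d c-beats-only-d d-beaten-by-b,c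
    where
    c-beats-only-d : ∀ {v} → v ∈ R → c ≻ v → v ≡ d
    c-beats-only-d = covers-all cov (λ v → c ≻ v → v ≡ d)
      (⊥-elim ∘ ≻-irrefl T) (λ _ → refl) (⊥-elim ∘ asym b≻c) (⊥-elim ∘ asym a≻c)
    d-beaten-by-b,c : ∀ {z} → z ∈ R → z ≻ d → z ≡ b ⊎ z ≡ c
    d-beaten-by-b,c = covers-all cov (λ z → z ≻ d → z ≡ b ⊎ z ≡ c)
      (λ _ → inj₂ refl) (⊥-elim ∘ ≻-irrefl T) (λ _ → inj₁ refl) (⊥-elim ∘ asym d≻a)

  no-out-degree-one : ∀ {x y u w} → Covers R x y u w → x ∈ R → y ∈ R → u ∈ R → w ∈ R → u ≢ w →
                      x ≻ y → u ≻ x → w ≻ x → ⊥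
  no-out-degree-one cov x∈R y∈R u∈R w∈R u≢w x≻y u≻x w≻x
    with complete (≻-≻⇒≢ T u≻x x≻y) | complete (≻-≻⇒≢ T w≻x x≻y)
  ... | inj₁ u≻y | inj₁ w≻y =
    no-sink₄ (λ v∈R v≢y v≢x v≢u v≢w → cov v∈R v≢x v≢y v≢u v≢w) y∈R x∈R x≻y u≻y w≻y
  ... | inj₁ u≻y | inj₂ y≻w = no-removable₄ cov x∈R u∈R u≻x u≻y w≻x y≻w
  ... | inj₂ y≻u | inj₁ w≻y =
    no-removable₄ (λ v∈R v≢x v≢y v≢w v≢u → cov v∈R v≢x v≢y v≢u v≢w) x∈R w∈R w≻x w≻y u≻x y≻u
  ... | inj₂ y≻u | inj₂ y≻w with complete u≢w
  ...   | inj₁ u≻w =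
    no-removable₄ (λ v∈R v≢w v≢x v≢u v≢y → cov v∈R v≢x v≢y v≢u v≢w) w∈R u∈R u≻w u≻x y≻w x≻y
  ...   | inj₂ w≻u =
    no-removable₄ (λ v∈R v≢u v≢x v≢w v≢y → cov v∈R v≢x v≢y v≢u v≢w) u∈R w∈R w≻u w≻x y≻u x≻y

  no-transitive-bottom : ∀ {q x p r} → Covers R q x p r → q ∈ R → x ∈ R → p ∈ R → r ∈ R →
                         x ≻ p → x ≻ q → p ≻ q → r ≻ x → ⊥
  no-transitive-bottom cov q∈R x∈R p∈R r∈R x≻p x≻q p≻q r≻x with complete (≻-≻⇒≢ T r≻x x≻q)
  ... | inj₁ r≻q = no-sink₄ cov q∈R x∈R x≻q p≻q r≻q
  ... | inj₂ q≻r = no-out-degree-one (λ v∈R v≢q v≢r v≢x v≢p → cov v∈R v≢q v≢x v≢p v≢r)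
                     q∈R r∈R x∈R p∈R (≻⇒≢ T x≻p) q≻r x≻q p≻q

  no-out-degree-two : ∀ {x p q r} → Covers R x p q r → x ∈ R → p ∈ R → q ∈ R → r ∈ R → p ≢ q →
                      x ≻ p → x ≻ q → r ≻ x → ⊥
  no-out-degree-two cov x∈R p∈R q∈R r∈R p≢q x≻p x≻q r≻x with complete p≢q
  ... | inj₁ p≻q = no-transitive-bottom (λ v∈R v≢q v≢x v≢p v≢r → cov v∈R v≢x v≢p v≢q v≢r)
                     q∈R x∈R p∈R r∈R x≻p x≻q p≻q r≻x
  ... | inj₂ q≻p = no-transitive-bottom (λ v∈R v≢p v≢x v≢q v≢r → cov v∈R v≢x v≢p v≢q v≢r)
                     p∈R x∈R q∈R r∈R x≻q x≻p q≻p r≻x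

  module _ (Q : FourElements R) where
    open FourElements Q

    no-fourElements : ⊥
    no-fourElements with complete a≢b | complete a≢c | complete a≢d
    ... | inj₁ a≻b | inj₁ a≻c | inj₁ a≻d = no-source₄ covers a∈R b∈R a≻b a≻c a≻d
    ... | inj₂ b≻a | inj₂ c≻a | inj₂ d≻a = no-sink₄ covers a∈R b∈R b≻a c≻a d≻a
    ... | inj₁ a≻b | inj₂ c≻a | inj₂ d≻a =
      no-out-degree-one covers a∈R b∈R c∈R d∈R c≢d a≻b c≻a d≻a
    ... | inj₂ b≻a | inj₁ a≻c | inj₂ d≻a =
      no-out-degree-one (λ v∈R v≢a v≢c v≢b v≢d → covers v∈R v≢a v≢b v≢c v≢d)
        a∈R c∈R b∈R d∈R b≢d a≻c b≻a d≻a
    ... | inj₂ b≻a | inj₂ c≻a | inj₁ a≻d =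
      no-out-degree-one (λ v∈R v≢a v≢d v≢b v≢c → covers v∈R v≢a v≢b v≢c v≢d)
        a∈R d∈R b∈R c∈R b≢c a≻d b≻a c≻a
    ... | inj₁ a≻b | inj₁ a≻c | inj₂ d≻a =
      no-out-degree-two covers a∈R b∈R c∈R d∈R b≢c a≻b a≻c d≻a
    ... | inj₁ a≻b | inj₂ c≻a | inj₁ a≻d =
      no-out-degree-two (λ v∈R v≢a v≢b v≢d v≢c → covers v∈R v≢a v≢b v≢c v≢d)
        a∈R b∈R d∈R c∈R b≢d a≻b a≻d c≻a
    ... | inj₂ b≻a | inj₁ a≻c | inj₁ a≻d =
      no-out-degree-two (λ v∈R v≢a v≢c v≢d v≢b → covers v∈R v≢a v≢b v≢c v≢d)
        a∈R c∈R d∈R b∈R c≢d a≻c a≻d b≻a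

theorem1 : (n : ℕ) (T : Tournament n) (R : Subset n) →
           MinimalτRetentive T ⊤ R → ∣ R ∣ ≢ 4
theorem1 zero          _ R _     ∣R∣≡4 = contradiction (subst (_≤ 0) ∣R∣≡4 (∣p∣≤n R)) λ ()
theorem1 (suc zero)    _ R _     ∣R∣≡4 = contradiction (subst (_≤ 1) ∣R∣≡4 (∣p∣≤n R)) λ { (s≤s ()) }
theorem1 (suc (suc _)) T R R-min ∣R∣≡4 = no-fourElements T R-min (∣p∣≡4⇒fourElements R ∣R∣≡4)
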